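{- For every integer $n\ge 1$, let $T_n$ be the graph with vertex set $\{v,x_0,x_1,\dots,x_n,w,x,u\}$ whose edges are: the path edges $vx_0,\ x_0x_1,\ x_1x_2,\ \dots,\ x_{n-1}x_n,\ x_nw$; the edges $xx_i$ for all $i=0,1,\dots,n$; and the edge $xu$. Then $T_n$ is a co-TT graph.
   Context: A graph $G=(V,E)$ is a threshold tolerance graph if each vertex $v$ can be assigned a positive weight $w_v$ and a positive tolerance $t_v$ such that for distinct $u,v$, $uv\in E$ iff $w_u+w_v>\min\{t_u,t_v\}$. A co-TT graph is the complement of a threshold tolerance graph. Equivalently (Monma–Reed–Trotter), $G$ is co-TT iff one can assign positive numbers $a_v,b_v$ to each vertex $v$ such that for distinct $x,y$: $xy\in E$ iff $a_x\le b_y$ and $a_y\le b_x$. -}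

module Defs where

open import Level using (0ℓ)
open import Data.Nat using (ℕ)
open import Data.Fin using (Fin; zero; suc; inject₁; fromℕ)
open import Data.Rational using (ℚ; 0ℚ; _<_; _+_; _⊓_)
open import Data.Product using (Σ; _×_)
open import Data.Sum using (_⊎_)
open import Relation.Nullary using (¬_)
open import Relation.Binary.PropositionalEquality using (_≡_)
open import Function.Bundles using (_⇔_)

-- A simple graph: a vertex type with an adjacency relation
-- (only pairs of distinct vertices are ever consulted).
record Graph : Set₁ where
  field
    Vertex : Set
    Adj    : Vertex → Vertex → Set
open Graph public

complement : Graph → Graph
complement G = record
  { Vertex = Vertex G
  ; Adj    = λ a b → (¬ a ≡ b) × ¬ Adj G a b }

IsTT : Graph → Set
IsTT G =
  Σ (Vertex G → ℚ) λ w → Σ (Vertex G → ℚ) λ t →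
    (∀ a → 0ℚ < w a) × (∀ a → 0ℚ < t a) ×
    (∀ a b → ¬ a ≡ b → (Adj G a b ⇔ (t a ⊓ t b < w a + w b)))

IsCoTT : Graph → Set
IsCoTT G = IsTT (complement G)

data TV (n : ℕ) : Set where
  v  : TV n
  xi : Fin (ℕ.suc n) → TV n
  w  : TV n
  x  : TV n
  u  : TV n

data TEdge (n : ℕ) : TV n → TV n → Set where
  e-vx0  : TEdge n v (xi zero)
  e-path : (i : Fin n) → TEdge n (xi (inject₁ i)) (xi (suc i))
  e-xnw  : TEdge n (xi (fromℕ n)) w
  e-xxi  : (i : Fin (ℕ.suc n)) → TEdge n x (xi i)
  e-xu   : TEdge n x u

T : ℕ → Graph
T n = record
  { Vertex = TV n
  ; Adj    = λ a b → TEdge n a b ⊎ TEdge n b a }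

-- Monma–Reed–Trotter in the easy direction: if every vertex p carries positive
-- numbers a p, b p with pq ∈ E iff a q ≤ b p and a p ≤ b q, then weights a and
-- tolerances a + b present the complement as a threshold tolerance graph, since
-- min (a p + b p) (a q + b q) < a p + a q says exactly that b p < a q or b q < a p.
-- For T n such numbers are found by hand: the path v, x₀, …, xₙ, w gets the
-- overlapping windows [2k + 2, 2k + 4] along its positions k, the hub x the window
-- [5, 2n + 5] meeting exactly the xᵢ, and the leaf u the reversed pair (2n + 5, 5),
-- which meets x and nothing else once n ≥ 1.
module Submission where

open import Defs
open import Data.Nat using (ℕ; zero; suc; _≤_; _<_; z≤n; s≤s; z<s)
import Data.Nat.Properties as ℕ
open import Data.Fin using (Fin; toℕ; inject₁; fromℕ) renaming (zero to fzero; suc to fsuc)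
open import Data.Fin.Properties using (toℕ-injective; toℕ-inject₁; toℕ-fromℕ; toℕ≤pred[n])
open import Data.Integer as ℤ using (+_; +≤+; +<+)
import Data.Integer.Properties as ℤ
open import Data.Rational as ℚ using (ℚ; 0ℚ; *≤*; *<*)
import Data.Rational.Properties as ℚ
open import Data.Rational.Literals using (fromℤ)
open import Data.Product using (_×_; _,_)
open import Data.Product.Function.NonDependent.Propositional using (_×-⇔_)
open import Data.Sum using (inj₁; inj₂)
open import Data.Empty using (⊥-elim)
open import Relation.Nullary using (¬_; yes; no; contradiction)
open import Relation.Nullary.Negation using (contraposition)
open import Relation.Binary.PropositionalEquality using (_≡_; refl; sym; trans; cong; subst; subst₂)
open import Relation.Binary using (tri<; tri≈; tri>)
open import Function.Bundles using (_⇔_; mk⇔; Equivalence)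
open import Function.Construct.Composition using (_⇔-∘_)

Overlap : {V A : Set} → (A → A → Set) → (lo hi : V → A) → V → V → Set
Overlap _≼_ lo hi p q = (lo q ≼ hi p) × (lo p ≼ hi q)

record CoTTRepresentation (G : Graph) : Set where
  field
    lo hi  : Vertex G → ℚ
    lo-pos : ∀ p → 0ℚ ℚ.< lo p
    hi-pos : ∀ p → 0ℚ ℚ.< hi p
    adj⇔   : ∀ p q → ¬ p ≡ q → Adj G p q ⇔ Overlap ℚ._≤_ lo hi p q

module _ where
  open import Data.Rational using (_+_; _⊓_)

  min-spans<sum-lows⇔¬overlap : ∀ a₁ b₁ a₂ b₂ →
    ((a₁ + b₁) ⊓ (a₂ + b₂) ℚ.< a₁ + a₂) ⇔ (¬ (a₂ ℚ.≤ b₁ × a₁ ℚ.≤ b₂))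
  min-spans<sum-lows⇔¬overlap a₁ b₁ a₂ b₂ = mk⇔ to from
    where
    sum-lows≤min-spans : a₂ ℚ.≤ b₁ × a₁ ℚ.≤ b₂ → a₁ + a₂ ℚ.≤ (a₁ + b₁) ⊓ (a₂ + b₂)
    sum-lows≤min-spans (a₂≤b₁ , a₁≤b₂) =
      ℚ.⊓-glb (ℚ.+-monoʳ-≤ a₁ a₂≤b₁)
              (subst (ℚ._≤ a₂ + b₂) (ℚ.+-comm a₂ a₁) (ℚ.+-monoʳ-≤ a₂ a₁≤b₂))

    to : (a₁ + b₁) ⊓ (a₂ + b₂) ℚ.< a₁ + a₂ → ¬ (a₂ ℚ.≤ b₁ × a₁ ℚ.≤ b₂)
    to min<sum meet = ℚ.<-irrefl refl (ℚ.<-≤-trans min<sum (sum-lows≤min-spans meet))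

    from : ¬ (a₂ ℚ.≤ b₁ × a₁ ℚ.≤ b₂) → (a₁ + b₁) ⊓ (a₂ + b₂) ℚ.< a₁ + a₂
    from disjoint with a₂ ℚ.≤? b₁ | a₁ ℚ.≤? b₂
    ... | yes a₂≤b₁ | yes a₁≤b₂ = contradiction (a₂≤b₁ , a₁≤b₂) disjoint
    ... | no a₂≰b₁ | _ =
      ℚ.≤-<-trans (ℚ.p⊓q≤p (a₁ + b₁) (a₂ + b₂)) (ℚ.+-monoʳ-< a₁ (ℚ.≰⇒> a₂≰b₁))
    ... | _ | no a₁≰b₂ =
      ℚ.≤-<-trans (ℚ.p⊓q≤q (a₁ + b₁) (a₂ + b₂))
        (subst (a₂ + b₂ ℚ.<_) (ℚ.+-comm a₂ a₁) (ℚ.+-monoʳ-< a₂ (ℚ.≰⇒> a₁≰b₂)))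

  coTT-fromRepresentation : {G : Graph} → CoTTRepresentation G → IsCoTT G
  coTT-fromRepresentation {G} R =
    lo , (λ p → lo p + hi p) , lo-pos , (λ p → ℚ.+-mono-< (lo-pos p) (hi-pos p)) , complement⇔
    where
    open CoTTRepresentation R
    open Equivalence using (to; from)
    complement⇔ : ∀ p q → ¬ p ≡ q →
      Adj (complement G) p q ⇔ ((lo p + hi p) ⊓ (lo q + hi q) ℚ.< lo p + lo q)
    complement⇔ p q p≢q = mk⇔
      (λ (_ , ¬adj) → from disjoint⇔ (contraposition (from (adj⇔ p q p≢q)) ¬adj))
      (λ min<sum → p≢q , contraposition (to (adj⇔ p q p≢q)) (to disjoint⇔ min<sum))
      where
      disjoint⇔ : ((lo p + hi p) ⊓ (lo q + hi q) ℚ.< lo p + lo q) ⇔ (¬ Overlap ℚ._≤_ lo hi p q)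
      disjoint⇔ = min-spans<sum-lows⇔¬overlap (lo p) (hi p) (lo q) (hi q)

toℚ : ℕ → ℚ
toℚ m = fromℤ (+ m)

toℚ-mono-< : ∀ {m k} → m < k → toℚ m ℚ.< toℚ k
toℚ-mono-< {m} {k} m<k =
  *<* (subst₂ ℤ._<_ (sym (ℤ.*-identityʳ (+ m))) (sym (ℤ.*-identityʳ (+ k))) (+<+ m<k))

toℚ-≤⇔ : ∀ {m k} → (m ≤ k) ⇔ (toℚ m ℚ.≤ toℚ k)
toℚ-≤⇔ {m} {k} = mk⇔
  (λ m≤k → *≤* (subst₂ ℤ._≤_ (sym (ℤ.*-identityʳ (+ m))) (sym (ℤ.*-identityʳ (+ k))) (+≤+ m≤k)))
  (λ { (*≤* m≤k) → ℤ.drop‿+≤+ (subst₂ ℤ._≤_ (ℤ.*-identityʳ (+ m)) (ℤ.*-identityʳ (+ k)) m≤k) })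

representation-fromℕ : {G : Graph} (lo hi : Vertex G → ℕ) →
  (∀ p → 0 < lo p) → (∀ p → 0 < hi p) →
  (∀ p q → ¬ p ≡ q → Adj G p q ⇔ Overlap _≤_ lo hi p q) →
  CoTTRepresentation G
representation-fromℕ lo hi lo-pos hi-pos adj⇔ = record
  { lo     = λ p → toℚ (lo p)
  ; hi     = λ p → toℚ (hi p)
  ; lo-pos = λ p → toℚ-mono-< (lo-pos p)
  ; hi-pos = λ p → toℚ-mono-< (hi-pos p)
  ; adj⇔   = λ p q p≢q → (toℚ-≤⇔ ×-⇔ toℚ-≤⇔) ⇔-∘ adj⇔ p q p≢q
  }

dbl : ℕ → ℕ
dbl zero    = zero
dbl (suc k) = suc (suc (dbl k))

dbl-mono-≤ : ∀ {m k} → m ≤ k → dbl m ≤ dbl k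
dbl-mono-≤ z≤n     = z≤n
dbl-mono-≤ (s≤s p) = s≤s (s≤s (dbl-mono-≤ p))

dbl-cancel-≤ : ∀ {m k} → dbl m ≤ dbl k → m ≤ k
dbl-cancel-≤ {zero}          _             = z≤n
dbl-cancel-≤ {suc m} {suc k} (s≤s (s≤s p)) = s≤s (dbl-cancel-≤ p)

module _ {n : ℕ} where
  open Data.Nat using (_+_)

  T-lo T-hi : TV n → ℕ
  T-lo v      = 2
  T-lo (xi i) = 4 + dbl (toℕ i)
  T-lo w      = 6 + dbl n
  T-lo x      = 5
  T-lo u      = 5 + dbl n
  T-hi v      = 4
  T-hi (xi i) = 6 + dbl (toℕ i)
  T-hi w      = 8 + dbl n
  T-hi x      = 5 + dbl n
  T-hi u      = 5

  T-lo-pos : ∀ p → 0 < T-lo p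
  T-lo-pos v      = z<s
  T-lo-pos (xi i) = z<s
  T-lo-pos w      = z<s
  T-lo-pos x      = z<s
  T-lo-pos u      = z<s

  T-hi-pos : ∀ p → 0 < T-hi p
  T-hi-pos v      = z<s
  T-hi-pos (xi i) = z<s
  T-hi-pos w      = z<s
  T-hi-pos x      = z<s
  T-hi-pos u      = z<s

  T-Overlap : TV n → TV n → Set
  T-Overlap = Overlap _≤_ T-lo T-hi

  path-edge : (i j : Fin (suc n)) → toℕ j ≡ suc (toℕ i) → TEdge n (xi i) (xi j)
  path-edge i (fsuc k) j≡1+i = subst (λ l → TEdge n (xi l) (xi (fsuc k))) inject₁k≡i (e-path k)
    where
    inject₁k≡i : inject₁ k ≡ i
    inject₁k≡i = toℕ-injective (trans (toℕ-inject₁ k) (ℕ.suc-injective j≡1+i))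

  last-edge : (i : Fin (suc n)) → n ≤ toℕ i → TEdge n (xi i) w
  last-edge i n≤i = subst (λ l → TEdge n (xi l) w) (sym i≡n) e-xnw
    where
    i≡n : i ≡ fromℕ n
    i≡n = toℕ-injective (trans (ℕ.≤-antisym (toℕ≤pred[n] i) n≤i) (sym (toℕ-fromℕ n)))

  near⇒adjacent : (i j : Fin (suc n)) → ¬ i ≡ j →
    toℕ j ≤ suc (toℕ i) → toℕ i ≤ suc (toℕ j) → Adj (T n) (xi i) (xi j)
  near⇒adjacent i j i≢j j≤1+i i≤1+j with ℕ.<-cmp (toℕ i) (toℕ j)
  ... | tri< i<j _ _ = inj₁ (path-edge i j (ℕ.≤-antisym j≤1+i i<j))
  ... | tri≈ _ i≡j _ = contradiction (toℕ-injective i≡j) i≢j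
  ... | tri> _ _ j<i = inj₂ (path-edge j i (ℕ.≤-antisym i≤1+j j<i))

  edge⇒overlap : ∀ {p q} → TEdge n p q → T-Overlap p q
  edge⇒overlap e-vx0 = ℕ.≤-refl , ℕ.m≤m+n 2 4
  edge⇒overlap (e-path i) rewrite toℕ-inject₁ i = ℕ.≤-refl , ℕ.m≤n+m (4 + dbl (toℕ i)) 4
  edge⇒overlap e-xnw rewrite toℕ-fromℕ n = ℕ.≤-refl , ℕ.m≤n+m (4 + dbl n) 4
  edge⇒overlap (e-xxi i) =
    ℕ.m≤n⇒m≤1+n (ℕ.+-monoʳ-≤ 4 (dbl-mono-≤ (toℕ≤pred[n] i))) , ℕ.m≤m+n 5 (suc (dbl (toℕ i)))
  edge⇒overlap e-xu = ℕ.≤-refl , ℕ.≤-refl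

  adjacent⇒overlap : ∀ p q → Adj (T n) p q → T-Overlap p q
  adjacent⇒overlap p q (inj₁ e) = edge⇒overlap e
  adjacent⇒overlap p q (inj₂ e) = let (lo-p≤hi-q , lo-q≤hi-p) = edge⇒overlap e
                                  in lo-q≤hi-p , lo-p≤hi-q

  x₀-ends-before-u : 1 ≤ n → T-hi (xi fzero) < T-lo u
  x₀-ends-before-u 1≤n = ℕ.+-monoʳ-≤ 5 (dbl-mono-≤ 1≤n)

  overlap⇒adjacent : 1 ≤ n → ∀ p q → ¬ p ≡ q → T-Overlap p q → Adj (T n) p q
  overlap⇒adjacent _ v v v≢v _ = contradiction refl v≢v
  overlap⇒adjacent _ v (xi fzero) _ _ = inj₁ e-vx0
  overlap⇒adjacent _ v (xi (fsuc j)) _ (h , _) = ⊥-elim (ℕ.m+1+n≰m 4 h)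
  overlap⇒adjacent _ v w _ (h , _) = ⊥-elim (ℕ.m+1+n≰m 4 h)
  overlap⇒adjacent _ v x _ (h , _) = ⊥-elim (ℕ.m+1+n≰m 4 h)
  overlap⇒adjacent _ v u _ (h , _) = ⊥-elim (ℕ.m+1+n≰m 4 h)
  overlap⇒adjacent _ (xi fzero) v _ _ = inj₂ e-vx0
  overlap⇒adjacent _ (xi (fsuc j)) v _ (_ , h) = ⊥-elim (ℕ.m+1+n≰m 4 h)
  overlap⇒adjacent _ (xi i) (xi j) xi≢xj (hj , hi) =
    near⇒adjacent i j (λ i≡j → xi≢xj (cong xi i≡j))
      (dbl-cancel-≤ (ℕ.+-cancelˡ-≤ 4 _ _ hj)) (dbl-cancel-≤ (ℕ.+-cancelˡ-≤ 4 _ _ hi))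
  overlap⇒adjacent _ (xi i) w _ (h , _) = inj₁ (last-edge i (dbl-cancel-≤ (ℕ.+-cancelˡ-≤ 6 _ _ h)))
  overlap⇒adjacent _ (xi i) x _ _ = inj₂ (e-xxi i)
  overlap⇒adjacent 1≤n (xi fzero) u _ (h , _) = ⊥-elim (ℕ.<⇒≱ (x₀-ends-before-u 1≤n) h)
  overlap⇒adjacent _ (xi (fsuc j)) u _ (_ , h) = ⊥-elim (ℕ.m+1+n≰m 5 h)
  overlap⇒adjacent _ w v _ (_ , h) = ⊥-elim (ℕ.m+1+n≰m 4 h)
  overlap⇒adjacent _ w (xi i) _ (_ , h) = inj₂ (last-edge i (dbl-cancel-≤ (ℕ.+-cancelˡ-≤ 6 _ _ h)))
  overlap⇒adjacent _ w w w≢w _ = contradiction refl w≢w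
  overlap⇒adjacent _ w x _ (_ , h) = ⊥-elim (ℕ.n≮n (5 + dbl n) h)
  overlap⇒adjacent _ w u _ (_ , h) = ⊥-elim (ℕ.m+1+n≰m 5 h)
  overlap⇒adjacent _ x v _ (_ , h) = ⊥-elim (ℕ.m+1+n≰m 4 h)
  overlap⇒adjacent _ x (xi i) _ _ = inj₁ (e-xxi i)
  overlap⇒adjacent _ x w _ (h , _) = ⊥-elim (ℕ.n≮n (5 + dbl n) h)
  overlap⇒adjacent _ x x x≢x _ = contradiction refl x≢x
  overlap⇒adjacent _ x u _ _ = inj₁ e-xu
  overlap⇒adjacent _ u v _ (_ , h) = ⊥-elim (ℕ.m+1+n≰m 4 h)
  overlap⇒adjacent 1≤n u (xi fzero) _ (_ , h) = ⊥-elim (ℕ.<⇒≱ (x₀-ends-before-u 1≤n) h)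
  overlap⇒adjacent _ u (xi (fsuc j)) _ (h , _) = ⊥-elim (ℕ.m+1+n≰m 5 h)
  overlap⇒adjacent _ u w _ (h , _) = ⊥-elim (ℕ.m+1+n≰m 5 h)
  overlap⇒adjacent _ u x _ _ = inj₂ e-xu
  overlap⇒adjacent _ u u u≢u _ = contradiction refl u≢u

T-representation : ∀ {n} → 1 ≤ n → CoTTRepresentation (T n)
T-representation 1≤n = representation-fromℕ T-lo T-hi T-lo-pos T-hi-pos
  (λ p q p≢q → mk⇔ (adjacent⇒overlap p q) (overlap⇒adjacent 1≤n p q p≢q))

lemma15 : (n : ℕ) → 1 ≤ n → IsCoTT (T n)
lemma15 n 1≤n = coTT-fromRepresentation (T-representation 1≤n)
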